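{- Let $n,k,s,t,i$ be positive integers with $(t+1)(k-t+1)\le n$, $t+3\le s\le 2k-t$ and $\max\{t+1,\,s+t-k\}\le i\le \min\{k,\frac{s+t}{2}\}$, and suppose $(s,i,t)\in\{(7,5,4),(8,5,3),(8,4,3),(7,5,3),(7,4,3)\}$. Define \[ S_1=s(n-s+1)-i(k-i),\qquad S_2=s(n-s+1)-(s+t-i)(k+i-s-t), \] \[ T_1=i(n-k-s+i+1)+(s-i)(k-i+1),\qquad T_2=(s+t-i)(n-k-i+t+1)+(i-t)(k-s-t+i+1). \] Then \[ \frac{(n-k-s+i)(n-k-i+t)S_1S_2}{(n-s+1)^2T_1T_2}>1. \] -}

module Defs where

open import Data.Nat using (ℕ)
open import Data.Integer using (ℤ; +_; _-_; _*_; _+_)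
open import Data.Product using (_×_)
open import Data.Sum using (_⊎_)
open import Relation.Binary.PropositionalEquality using (_≡_)

-- the quantities of the statement, computed in ℤ (so that subtraction is genuine)
S₁ : ℕ → ℕ → ℕ → ℕ → ℕ → ℤ
S₁ n k s t i = (+ s) * ((+ n) - (+ s) + + 1) - (+ i) * ((+ k) - (+ i))

S₂ : ℕ → ℕ → ℕ → ℕ → ℕ → ℤ
S₂ n k s t i = (+ s) * ((+ n) - (+ s) + + 1)
             - ((+ s) + (+ t) - (+ i)) * ((+ k) + (+ i) - (+ s) - (+ t))

T₁ : ℕ → ℕ → ℕ → ℕ → ℕ → ℤ
T₁ n k s t i = (+ i) * ((+ n) - (+ k) - (+ s) + (+ i) + + 1)
             + ((+ s) - (+ i)) * ((+ k) - (+ i) + + 1)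

T₂ : ℕ → ℕ → ℕ → ℕ → ℕ → ℤ
T₂ n k s t i = ((+ s) + (+ t) - (+ i)) * ((+ n) - (+ k) - (+ i) + (+ t) + + 1)
             + ((+ i) - (+ t)) * ((+ k) - (+ s) - (+ t) + (+ i) + + 1)

Num : ℕ → ℕ → ℕ → ℕ → ℕ → ℤ
Num n k s t i = ((+ n) - (+ k) - (+ s) + (+ i)) * ((+ n) - (+ k) - (+ i) + (+ t))
              * S₁ n k s t i * S₂ n k s t i

Den : ℕ → ℕ → ℕ → ℕ → ℕ → ℤ
Den n k s t i = ((+ n) - (+ s) + + 1) * ((+ n) - (+ s) + + 1)
              * T₁ n k s t i * T₂ n k s t i

SpecialTriple : ℕ → ℕ → ℕ → Set
SpecialTriple s i t =
    (s ≡ 7 × i ≡ 5 × t ≡ 4)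
  ⊎ (s ≡ 8 × i ≡ 5 × t ≡ 3)
  ⊎ (s ≡ 8 × i ≡ 4 × t ≡ 3)
  ⊎ (s ≡ 7 × i ≡ 5 × t ≡ 3)
  ⊎ (s ≡ 7 × i ≡ 4 × t ≡ 3)

{-# OPTIONS --safe #-}
module Submission where

-- Writing k = (s + t - i) + a and n = (t + 1)(k - t + 1) + b with a, b ∈ ℕ, each of the
-- seven factors of the numerator and the denominator becomes an affine form in (a, b),
-- and for the five triples all its coefficients are natural numbers.  The numerator minus
-- the denominator is then a polynomial of degree 4 in (a, b) with natural coefficients
-- and a positive constant term, which is checked by computing with dense polynomials over
-- ℕ; so Num > Den > 0.

open import Defs
open import Data.Nat using (ℕ; _≤_; _+_; _*_; _∸_; _⊔_; _⊓_)
open import Data.Product using (Σ; _×_)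
open import Data.Rational using (ℚ; NonZero; _÷_; _<_; 1ℚ; _/_)

import Data.Nat as ℕ
open import Data.Nat.Properties
  using (+-identityʳ; *-zeroʳ; *-assoc; *-distribˡ-+; *-distribʳ-+; +-commutativeSemigroup;
         *-commutativeSemigroup; ≤-trans; ≤-reflexive; m≤m+n; m<m+n; m+n∸m≡n; +-assoc;
         m≤n⇒∃[o]m+o≡n; m≤n+m∸n; +-monoʳ-≤; +-cancelʳ-≤; m≤n⊔m; module ≤-Reasoning)
import Data.Nat.Tactic.RingSolver as ℕ-Solver
import Data.Integer as ℤ
open ℤ using (ℤ; +_; -_; _-_; ∣_∣; 0ℤ; +<+; NonNegative)
open import Data.Integer.Properties using (pos-*; 0≤i⇒+∣i∣≡i; nonNegative⁻¹)
import Data.Integer.Properties as ℤ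
open import Data.Integer.Tactic.RingSolver using (solve-∀)
open import Data.Rational using (Positive; 1/_; positive)
import Data.Rational.Properties as ℚ
import Data.Rational.Unnormalised as ℚᵘ
import Data.Rational.Unnormalised.Properties as ℚᵘ
open import Data.List using (List; []; _∷_; map)
open import Data.Product using (_,_)
open import Data.Sum using (inj₁; inj₂)
open import Relation.Binary.PropositionalEquality
open import Algebra.Properties.CommutativeSemigroup +-commutativeSemigroup using (interchange)
open import Algebra.Properties.CommutativeSemigroup *-commutativeSemigroup using (x∙yz≈y∙xz)

-- x / 1 is definitionally fromℚᵘ (mkℚᵘ x 0).
/1-mono-< : ∀ {x y : ℤ} → x ℤ.< y → x / 1 < y / 1
/1-mono-< {x} {y} x<y = ℚ.toℚᵘ-cancel-<
  (ℚᵘ.<-respʳ-≃ (ℚᵘ.≃-sym (ℚ.toℚᵘ-fromℚᵘ (ℚᵘ.mkℚᵘ y 0)))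
    (ℚᵘ.<-respˡ-≃ (ℚᵘ.≃-sym (ℚ.toℚᵘ-fromℚᵘ (ℚᵘ.mkℚᵘ x 0)))
      (ℚᵘ.*<* (subst₂ ℤ._<_ (sym (ℤ.*-identityʳ x)) (sym (ℤ.*-identityʳ y)) x<y))))

÷-*-cancel : ∀ p q .{{_ : NonZero q}} → (p ÷ q) Data.Rational.* q ≡ p
÷-*-cancel p q = trans (ℚ.*-assoc p (1/ q) q)
  (trans (cong (p Data.Rational.*_) (ℚ.*-inverseˡ q)) (ℚ.*-identityʳ p))

1<p÷q : ∀ p q .{{_ : Positive q}} → q < p → 1ℚ < _÷_ p q {{ℚ.pos⇒nonZero q}}
1<p÷q p q q<p = ℚ.*-cancelʳ-<-nonNeg q {{ℚ.pos⇒nonNeg q}}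
  (subst₂ _<_ (sym (ℚ.*-identityˡ q)) (sym (÷-*-cancel p q {{ℚ.pos⇒nonZero q}})) q<p)

1<x/1÷y/1 : ∀ {x y : ℤ} → 0ℤ ℤ.< y → y ℤ.< x →
  Σ (NonZero (y / 1)) (λ nz → 1ℚ < _÷_ (x / 1) (y / 1) {{nz}})
1<x/1÷y/1 {x} {y} 0<y y<x = ℚ.pos⇒nonZero (y / 1) , 1<p÷q (x / 1) (y / 1) (/1-mono-< y<x)
  where
  instance
    y/1-positive : Positive (y / 1)
    y/1-positive = positive (/1-mono-< 0<y)

module Dense {C : Set} (_⊕_ _⊗_ _⊖_ : C → C → C) (𝟘 : C) where

  infixl 6 _⊞_ _⊟_
  infixl 7 _⊠_

  _⊞_ : List C → List C → List C
  []      ⊞ q       = q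
  (c ∷ p) ⊞ []      = c ∷ p
  (c ∷ p) ⊞ (d ∷ q) = (c ⊕ d) ∷ (p ⊞ q)

  _⊟_ : List C → List C → List C
  []      ⊟ _       = []
  (c ∷ p) ⊟ []      = c ∷ p
  (c ∷ p) ⊟ (d ∷ q) = (c ⊖ d) ∷ (p ⊟ q)

  _⊠_ : List C → List C → List C
  []      ⊠ q = []
  (c ∷ p) ⊠ q = map (c ⊗_) q ⊞ (𝟘 ∷ p ⊠ q)

  lowest : List C → C
  lowest []      = 𝟘
  lowest (c ∷ _) = c

  module Evaluation (⟦_⟧ : C → ℕ)
    (⟦⊕⟧ : ∀ c d → ⟦ c ⊕ d ⟧ ≡ ⟦ c ⟧ + ⟦ d ⟧)
    (⟦⊗⟧ : ∀ c d → ⟦ c ⊗ d ⟧ ≡ ⟦ c ⟧ * ⟦ d ⟧)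
    (⟦𝟘⟧ : ⟦ 𝟘 ⟧ ≡ 0)
    where

    open ≡-Reasoning

    eval : List C → ℕ → ℕ
    eval []      x = 0
    eval (c ∷ p) x = ⟦ c ⟧ + x * eval p x

    eval-⊞ : ∀ p q x → eval (p ⊞ q) x ≡ eval p x + eval q x
    eval-⊞ []      q       x = refl
    eval-⊞ (c ∷ p) []      x = sym (+-identityʳ _)
    eval-⊞ (c ∷ p) (d ∷ q) x = begin
      ⟦ c ⊕ d ⟧ + x * eval (p ⊞ q) x
        ≡⟨ cong₂ (λ u v → u + x * v) (⟦⊕⟧ c d) (eval-⊞ p q x) ⟩
      ⟦ c ⟧ + ⟦ d ⟧ + x * (eval p x + eval q x)
        ≡⟨ cong (λ z → ⟦ c ⟧ + ⟦ d ⟧ + z) (*-distribˡ-+ x _ _) ⟩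
      ⟦ c ⟧ + ⟦ d ⟧ + (x * eval p x + x * eval q x)
        ≡⟨ interchange ⟦ c ⟧ ⟦ d ⟧ (x * eval p x) (x * eval q x) ⟩
      eval (c ∷ p) x + eval (d ∷ q) x
        ∎

    eval-map : ∀ c q x → eval (map (c ⊗_) q) x ≡ ⟦ c ⟧ * eval q x
    eval-map c []      x = sym (*-zeroʳ ⟦ c ⟧)
    eval-map c (d ∷ q) x = begin
      ⟦ c ⊗ d ⟧ + x * eval (map (c ⊗_) q) x
        ≡⟨ cong₂ (λ u v → u + x * v) (⟦⊗⟧ c d) (eval-map c q x) ⟩
      ⟦ c ⟧ * ⟦ d ⟧ + x * (⟦ c ⟧ * eval q x)
        ≡⟨ cong (λ z → ⟦ c ⟧ * ⟦ d ⟧ + z) (x∙yz≈y∙xz x ⟦ c ⟧ _) ⟩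
      ⟦ c ⟧ * ⟦ d ⟧ + ⟦ c ⟧ * (x * eval q x)
        ≡⟨ *-distribˡ-+ ⟦ c ⟧ _ _ ⟨
      ⟦ c ⟧ * eval (d ∷ q) x
        ∎

    eval-⊠ : ∀ p q x → eval (p ⊠ q) x ≡ eval p x * eval q x
    eval-⊠ []      q x = refl
    eval-⊠ (c ∷ p) q x = begin
      eval (map (c ⊗_) q ⊞ (𝟘 ∷ p ⊠ q)) x
        ≡⟨ eval-⊞ (map (c ⊗_) q) _ x ⟩
      eval (map (c ⊗_) q) x + (⟦ 𝟘 ⟧ + x * eval (p ⊠ q) x)
        ≡⟨ cong₂ (λ u v → eval (map (c ⊗_) q) x + (u + x * v)) ⟦𝟘⟧ (eval-⊠ p q x) ⟩
      eval (map (c ⊗_) q) x + x * (eval p x * eval q x)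
        ≡⟨ cong₂ _+_ (eval-map c q x) (sym (*-assoc x _ _)) ⟩
      ⟦ c ⟧ * eval q x + x * eval p x * eval q x
        ≡⟨ *-distribʳ-+ (eval q x) ⟦ c ⟧ _ ⟨
      eval (c ∷ p) x * eval q x
        ∎

    lowest≤eval : ∀ p x → ⟦ lowest p ⟧ ≤ eval p x
    lowest≤eval []      x = ≤-reflexive ⟦𝟘⟧
    lowest≤eval (c ∷ p) x = m≤m+n ⟦ c ⟧ _

module ℕ[X] = Dense ℕ._+_ ℕ._*_ ℕ._∸_ 0
module ℕ[X]-eval = ℕ[X].Evaluation (λ c → c) (λ _ _ → refl) (λ _ _ → refl) refl

-- Polynomials in Y with coefficients in ℕ[X], lowest degree first.
Poly₂ : Set
Poly₂ = List (List ℕ)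

module ℕ[X,Y] = Dense ℕ[X]._⊞_ ℕ[X]._⊠_ ℕ[X]._⊟_ []
module ℕ[X,Y]-eval (x : ℕ) = ℕ[X,Y].Evaluation (λ p → ℕ[X]-eval.eval p x)
  (λ p q → ℕ[X]-eval.eval-⊞ p q x) (λ p q → ℕ[X]-eval.eval-⊠ p q x) refl

open ℕ[X,Y] using (_⊞_; _⊠_; _⊟_)

eval₂ : Poly₂ → ℕ → ℕ → ℕ
eval₂ P x y = ℕ[X,Y]-eval.eval x P y

constant : Poly₂ → ℕ
constant P = ℕ[X].lowest (ℕ[X,Y].lowest P)

constant≤eval₂ : ∀ P x y → constant P ≤ eval₂ P x y
constant≤eval₂ P x y =
  ≤-trans (ℕ[X]-eval.lowest≤eval (ℕ[X,Y].lowest P) x) (ℕ[X,Y]-eval.lowest≤eval x P y)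

linear : ℕ → ℕ → ℕ → Poly₂
linear c p q = (c ∷ p ∷ []) ∷ (q ∷ []) ∷ []

eval₂-linear : ∀ c p q x y → eval₂ (linear c p q) x y ≡ c + p * x + q * y
eval₂-linear c p q x y = horner c p q x y
  where
  horner : ∀ c p q x y → c + x * (p + x * 0) + y * (q + x * 0 + y * 0) ≡ c + p * x + q * y
  horner = ℕ-Solver.solve-∀

+eval₂-⊠ : ∀ {u v : ℤ} P Q x y → u ≡ + eval₂ P x y → v ≡ + eval₂ Q x y →
  u ℤ.* v ≡ + eval₂ (P ⊠ Q) x y
+eval₂-⊠ P Q x y refl refl =
  trans (sym (pos-* (eval₂ P x y) (eval₂ Q x y))) (cong +_ (sym (ℕ[X,Y]-eval.eval-⊠ x P Q y)))

-- value is the corresponding formula of Defs read over ℤ, so Num and Den unfold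
-- definitionally to products of values.
record AffineFactor : Set where
  field
    value : (n k s t i : ℤ) → ℤ
    α β γ : (s t i : ℤ) → ℤ
    expansion : ∀ n k s t i → value n k s t i ≡ α s t i ℤ.+ β s t i ℤ.* n ℤ.+ γ s t i ℤ.* k

𝔸₁ 𝔸₂ 𝔹 𝕊₁ 𝕊₂ 𝕋₁ 𝕋₂ : AffineFactor
𝔸₁ = record
  { value = λ n k s _ i → n - k - s ℤ.+ i
  ; α = λ s _ i → i - s ; β = λ _ _ _ → + 1 ; γ = λ _ _ _ → - + 1
  ; expansion = solve-∀ }
𝔸₂ = record
  { value = λ n k _ t i → n - k - i ℤ.+ t
  ; α = λ _ t i → t - i ; β = λ _ _ _ → + 1 ; γ = λ _ _ _ → - + 1
  ; expansion = solve-∀ }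
𝔹 = record
  { value = λ n _ s _ _ → n - s ℤ.+ + 1
  ; α = λ s _ _ → + 1 - s ; β = λ _ _ _ → + 1 ; γ = λ _ _ _ → 0ℤ
  ; expansion = solve-∀ }
𝕊₁ = record
  { value = λ n k s _ i → s ℤ.* (n - s ℤ.+ + 1) - i ℤ.* (k - i)
  ; α = λ s _ i → s ℤ.* (+ 1 - s) ℤ.+ i ℤ.* i ; β = λ s _ _ → s ; γ = λ _ _ i → - i
  ; expansion = solve-∀ }
𝕊₂ = record
  { value = λ n k s t i → s ℤ.* (n - s ℤ.+ + 1) - (s ℤ.+ t - i) ℤ.* (k ℤ.+ i - s - t)
  ; α = λ s t i → s ℤ.* (+ 1 - s) ℤ.+ (s ℤ.+ t - i) ℤ.* (s ℤ.+ t - i)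
  ; β = λ s _ _ → s ; γ = λ s t i → - (s ℤ.+ t - i)
  ; expansion = solve-∀ }
𝕋₁ = record
  { value = λ n k s _ i → i ℤ.* (n - k - s ℤ.+ i ℤ.+ + 1) ℤ.+ (s - i) ℤ.* (k - i ℤ.+ + 1)
  ; α = λ s _ i → i ℤ.* (i - s ℤ.+ + 1) ℤ.+ (s - i) ℤ.* (+ 1 - i)
  ; β = λ _ _ i → i ; γ = λ s _ i → s - i - i
  ; expansion = solve-∀ }
𝕋₂ = record
  { value = λ n k s t i → (s ℤ.+ t - i) ℤ.* (n - k - i ℤ.+ t ℤ.+ + 1)
                          ℤ.+ (i - t) ℤ.* (k - s - t ℤ.+ i ℤ.+ + 1)
  ; α = λ s t i → (s ℤ.+ t - i) ℤ.* (t - i ℤ.+ + 1) ℤ.+ (i - t) ℤ.* (i - s - t ℤ.+ + 1)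
  ; β = λ s t i → s ℤ.+ t - i ; γ = λ s t i → (i - t) - (s ℤ.+ t - i)
  ; expansion = solve-∀ }

+∣x∣≡x : ∀ x .{{_ : NonNegative x}} → + ∣ x ∣ ≡ x
+∣x∣≡x x = 0≤i⇒+∣i∣≡i (nonNegative⁻¹ x)

-- k = κ + a, n = ν + τ a + b with a, b ∈ ℕ range exactly over k ≥ κ, n ≥ τ (k - t + 1).
module Cone (s t i d : ℕ) where

  κ τ ν : ℕ
  κ = t + d
  τ = t + 1
  ν = τ * (d + 1)

  cone-edge : ∀ a → τ * (κ + a ∸ t + 1) ≡ ν + τ * a
  cone-edge a = begin
    τ * (t + d + a ∸ t + 1)   ≡⟨ cong (λ m → τ * (m ∸ t + 1)) (+-assoc t d a) ⟩
    τ * (t + (d + a) ∸ t + 1) ≡⟨ cong (λ m → τ * (m + 1)) (m+n∸m≡n t (d + a)) ⟩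
    τ * (d + a + 1)           ≡⟨ distribute τ d a ⟩
    ν + τ * a                 ∎
    where
    open ≡-Reasoning
    distribute : ∀ τ d a → τ * (d + a + 1) ≡ τ * (d + 1) + τ * a
    distribute = ℕ-Solver.solve-∀

  k-lower-bound : ∀ {k} → s + t ≡ κ + i → (t + 1) ⊔ (s + t ∸ k) ≤ i → κ ≤ k
  k-lower-bound {k} s+t≡κ+i bound = +-cancelʳ-≤ i κ k (begin
    κ + i              ≡⟨ s+t≡κ+i ⟨
    s + t              ≤⟨ m≤n+m∸n (s + t) k ⟩
    k + (s + t ∸ k)    ≤⟨ +-monoʳ-≤ k (≤-trans (m≤n⊔m (t + 1) (s + t ∸ k)) bound) ⟩
    k + i              ∎)
    where open ≤-Reasoning

  value-at : AffineFactor → ℕ → ℕ → ℤ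
  value-at F n k = AffineFactor.value F (+ n) (+ k) (+ s) (+ t) (+ i)

  vertex slopeᵃ slopeᵇ : AffineFactor → ℤ
  vertex F = let open AffineFactor F in
    α (+ s) (+ t) (+ i) ℤ.+ β (+ s) (+ t) (+ i) ℤ.* + ν ℤ.+ γ (+ s) (+ t) (+ i) ℤ.* + κ
  slopeᵃ F = let open AffineFactor F in β (+ s) (+ t) (+ i) ℤ.* + τ ℤ.+ γ (+ s) (+ t) (+ i)
  slopeᵇ F = let open AffineFactor F in β (+ s) (+ t) (+ i)

  restrict : ∀ F a b →
    value-at F (ν + τ * a + b) (κ + a) ≡ vertex F ℤ.+ slopeᵃ F ℤ.* + a ℤ.+ slopeᵇ F ℤ.* + b
  restrict F a b = begin
    value (+ (ν + τ * a + b)) (+ (κ + a)) S T I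
      ≡⟨ expansion _ _ S T I ⟩
    α S T I ℤ.+ β S T I ℤ.* (+ ν ℤ.+ + (τ * a) ℤ.+ + b) ℤ.+ γ S T I ℤ.* (+ κ ℤ.+ + a)
      ≡⟨ cong (λ z → α S T I ℤ.+ β S T I ℤ.* (+ ν ℤ.+ z ℤ.+ + b) ℤ.+ γ S T I ℤ.* (+ κ ℤ.+ + a))
              (pos-* τ a) ⟩
    α S T I ℤ.+ β S T I ℤ.* (+ ν ℤ.+ + τ ℤ.* + a ℤ.+ + b) ℤ.+ γ S T I ℤ.* (+ κ ℤ.+ + a)
      ≡⟨ regroup (α S T I) (β S T I) (γ S T I) (+ ν) (+ τ) (+ κ) (+ a) (+ b) ⟩
    vertex F ℤ.+ slopeᵃ F ℤ.* + a ℤ.+ slopeᵇ F ℤ.* + b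
      ∎
    where
    open AffineFactor F
    open ≡-Reasoning
    S = + s ; T = + t ; I = + i
    regroup : ∀ α β γ N T K A B →
      α ℤ.+ β ℤ.* (N ℤ.+ T ℤ.* A ℤ.+ B) ℤ.+ γ ℤ.* (K ℤ.+ A)
        ≡ (α ℤ.+ β ℤ.* N ℤ.+ γ ℤ.* K) ℤ.+ (β ℤ.* T ℤ.+ γ) ℤ.* A ℤ.+ β ℤ.* B
    regroup = solve-∀

  record NaturalOnCone (F : AffineFactor) : Set where
    field
      {{vertex≥0}} : NonNegative (vertex F)
      {{slopeᵃ≥0}} : NonNegative (slopeᵃ F)
      {{slopeᵇ≥0}} : NonNegative (slopeᵇ F)

  restriction : AffineFactor → Poly₂
  restriction F = linear (∣ vertex F ∣) (∣ slopeᵃ F ∣) (∣ slopeᵇ F ∣)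

  restrict-natural : ∀ F {{_ : NaturalOnCone F}} a b →
    value-at F (ν + τ * a + b) (κ + a) ≡ + eval₂ (restriction F) a b
  restrict-natural F a b = begin
    value-at F (ν + τ * a + b) (κ + a)
      ≡⟨ restrict F a b ⟩
    vertex F ℤ.+ slopeᵃ F ℤ.* + a ℤ.+ slopeᵇ F ℤ.* + b
      ≡⟨ cong₂ (λ u w → u ℤ.+ w ℤ.* + b)
           (cong₂ (λ u v → u ℤ.+ v ℤ.* + a) (+∣x∣≡x (vertex F)) (+∣x∣≡x (slopeᵃ F)))
           (+∣x∣≡x (slopeᵇ F)) ⟨
    + c ℤ.+ + p ℤ.* + a ℤ.+ + q ℤ.* + b
      ≡⟨ cong₂ (λ u v → + c ℤ.+ u ℤ.+ v) (pos-* p a) (pos-* q b) ⟨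
    + (c + p * a + q * b)
      ≡⟨ cong +_ (eval₂-linear c p q a b) ⟨
    + eval₂ (restriction F) a b
      ∎
    where
    open ≡-Reasoning
    c = ∣ vertex F ∣ ; p = ∣ slopeᵃ F ∣ ; q = ∣ slopeᵇ F ∣

  product-on-cone : ∀ F₁ F₂ F₃ F₄
    {{_ : NaturalOnCone F₁}} {{_ : NaturalOnCone F₂}} →
    {{_ : NaturalOnCone F₃}} {{_ : NaturalOnCone F₄}} → ∀ a b →
    let n = ν + τ * a + b ; k = κ + a in
    value-at F₁ n k ℤ.* value-at F₂ n k ℤ.* value-at F₃ n k ℤ.* value-at F₄ n k
      ≡ + eval₂ (restriction F₁ ⊠ restriction F₂ ⊠ restriction F₃ ⊠ restriction F₄) a b
  product-on-cone F₁ F₂ F₃ F₄ a b =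
    +eval₂-⊠ (R₁ ⊠ R₂ ⊠ R₃) R₄ a b
      (+eval₂-⊠ (R₁ ⊠ R₂) R₃ a b (+eval₂-⊠ R₁ R₂ a b (on F₁) (on F₂)) (on F₃)) (on F₄)
    where
    R₁ = restriction F₁ ; R₂ = restriction F₂ ; R₃ = restriction F₃ ; R₄ = restriction F₄
    on : ∀ F {{_ : NaturalOnCone F}} →
      value-at F (ν + τ * a + b) (κ + a) ≡ + eval₂ (restriction F) a b
    on F = restrict-natural F a b

  numerator denominator residual : Poly₂
  numerator   = restriction 𝔸₁ ⊠ restriction 𝔸₂ ⊠ restriction 𝕊₁ ⊠ restriction 𝕊₂
  denominator = restriction 𝔹 ⊠ restriction 𝔹 ⊠ restriction 𝕋₁ ⊠ restriction 𝕋₂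
  residual    = numerator ⊟ denominator

  -- As ⊟ truncates, numerator-split holds only if no coefficient of denominator exceeds
  -- that of numerator.  For concrete s t i d the instance fields are closed and found by
  -- computation.
  record Certificate : Set where
    field
      vertex-on-boundary : s + t ≡ κ + i
      {{𝔸₁-natural}} : NaturalOnCone 𝔸₁
      {{𝔸₂-natural}} : NaturalOnCone 𝔸₂
      {{𝔹-natural}}  : NaturalOnCone 𝔹
      {{𝕊₁-natural}} : NaturalOnCone 𝕊₁
      {{𝕊₂-natural}} : NaturalOnCone 𝕊₂
      {{𝕋₁-natural}} : NaturalOnCone 𝕋₁
      {{𝕋₂-natural}} : NaturalOnCone 𝕋₂
      numerator-split : numerator ≡ denominator ⊞ residual
      {{denominator-pos}} : ℕ.NonZero (constant denominator)
      {{residual-pos}}    : ℕ.NonZero (constant residual)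

  1<Num÷Den : Certificate → ∀ n k → τ * (k ∸ t + 1) ≤ n → (t + 1) ⊔ (s + t ∸ k) ≤ i →
    Σ (NonZero (Den n k s t i / 1)) (λ nz → 1ℚ < _÷_ (Num n k s t i / 1) (Den n k s t i / 1) {{nz}})
  1<Num÷Den certificate n k n-bound k-bound
    with m≤n⇒∃[o]m+o≡n (k-lower-bound {k} (Certificate.vertex-on-boundary certificate) k-bound)
  ... | a , refl with m≤n⇒∃[o]m+o≡n (subst (_≤ n) (cone-edge a) n-bound)
  ... | b , refl = 1<x/1÷y/1 (subst (0ℤ ℤ.<_) (sym Den≡) (+<+ 0<D))
                             (subst₂ ℤ._<_ (sym Den≡) (sym Num≡) (+<+ (m<m+n D 0<R)))
    where
    open Certificate certificate
    D = eval₂ denominator a b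
    R = eval₂ residual a b
    0<D : 0 ℕ.< D
    0<D = ≤-trans (ℕ.>-nonZero⁻¹ _) (constant≤eval₂ denominator a b)
    0<R : 0 ℕ.< R
    0<R = ≤-trans (ℕ.>-nonZero⁻¹ _) (constant≤eval₂ residual a b)
    Den≡ : Den (ν + τ * a + b) (κ + a) s t i ≡ + D
    Den≡ = product-on-cone 𝔹 𝔹 𝕋₁ 𝕋₂ a b
    Num≡ : Num (ν + τ * a + b) (κ + a) s t i ≡ + (D + R)
    Num≡ = trans (product-on-cone 𝔸₁ 𝔸₂ 𝕊₁ 𝕊₂ a b) (cong +_ (begin
      eval₂ numerator a b                ≡⟨ cong (λ P → eval₂ P a b) numerator-split ⟩
      eval₂ (denominator ⊞ residual) a b ≡⟨ ℕ[X,Y]-eval.eval-⊞ a denominator residual b ⟩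
      D + R                              ∎))
      where open ≡-Reasoning

-- Outside Cone, so that it is in scope where certificates are built.
instance
  natural-on-cone : ∀ {s t i d F} → let open Cone s t i d in
    {{NonNegative (vertex F)}} → {{NonNegative (slopeᵃ F)}} → {{NonNegative (slopeᵇ F)}} →
    NaturalOnCone F
  natural-on-cone = record {}

lemma5p1 : (n k s t i : ℕ) → 1 ≤ n → 1 ≤ k → 1 ≤ s → 1 ≤ t → 1 ≤ i →
    (t + 1) * (k ∸ t + 1) ≤ n →
    t + 3 ≤ s → s + t ≤ 2 * k →
    (t + 1) ⊔ ((s + t) ∸ k) ≤ i → i ≤ k → 2 * i ≤ s + t →
    SpecialTriple s i t →
    Σ (NonZero (Den n k s t i / 1))
      (λ nz → 1ℚ < _÷_ (Num n k s t i / 1) (Den n k s t i / 1) {{nz}})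
lemma5p1 n k _ _ _ _ _ _ _ _ n-bound _ _ k-bound _ _ (inj₁ (refl , refl , refl)) =
  Cone.1<Num÷Den 7 4 5 2
    record { vertex-on-boundary = refl ; numerator-split = refl } n k n-bound k-bound
lemma5p1 n k _ _ _ _ _ _ _ _ n-bound _ _ k-bound _ _ (inj₂ (inj₁ (refl , refl , refl))) =
  Cone.1<Num÷Den 8 3 5 3
    record { vertex-on-boundary = refl ; numerator-split = refl } n k n-bound k-bound
lemma5p1 n k _ _ _ _ _ _ _ _ n-bound _ _ k-bound _ _ (inj₂ (inj₂ (inj₁ (refl , refl , refl)))) =
  Cone.1<Num÷Den 8 3 4 4
    record { vertex-on-boundary = refl ; numerator-split = refl } n k n-bound k-bound
lemma5p1 n k _ _ _ _ _ _ _ _ n-bound _ _ k-bound _ _ (inj₂ (inj₂ (inj₂ (inj₁ (refl , refl , refl))))) =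
  Cone.1<Num÷Den 7 3 5 2
    record { vertex-on-boundary = refl ; numerator-split = refl } n k n-bound k-bound
lemma5p1 n k _ _ _ _ _ _ _ _ n-bound _ _ k-bound _ _ (inj₂ (inj₂ (inj₂ (inj₂ (refl , refl , refl))))) =
  Cone.1<Num÷Den 7 3 4 3
    record { vertex-on-boundary = refl ; numerator-split = refl } n k n-bound k-bound
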